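{- Let $H=(V,E)$ be a 2-colorable hypergraph with at least one edge. Then \[ \operatorname{ch}(H)\le\left\lceil\frac{\Delta(H)}{s(H)}\right\rceil+1, \] where $\Delta(H)$ is the maximum degree of a vertex of $H$ and $s(H)$ is the minimum size of an edge of $H$.
   Context: A hypergraph is a pair $H=(V,E)$ with $V$ finite and $E\subset 2^V$; the degree of a vertex $v$ is the number of edges containing $v$. A coloring is proper if every edge contains two vertices of different colors; $H$ is 2-colorable if it has a proper coloring with 2 colors. $H$ is $k$-choosable if for every assignment of lists $L(v)$ of colors with $|L(v)|=k$ for all $v$ there is a proper coloring assigning each $v$ a color from $L(v)$; $\operatorname{ch}(H)$ is the minimum such $k$. -}

module Defs where

open import Data.Nat using (ℕ; zero; suc; _+_; _*_; _≤_; _⊔_; _⊓_)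
open import Data.Nat.DivMod using (_/_)
open import Data.Fin using (Fin)
open import Data.Fin.Subset using (Subset; _∈_; ∣_∣)
open import Data.Fin.Subset.Properties using (_∈?_)
open import Data.List using (List; []; _∷_; length; filter; map; foldr; allFin)
open import Data.List.Relation.Unary.All using (All)
open import Data.List.Relation.Unary.Unique.Propositional using (Unique)
open import Data.List.Membership.Propositional using () renaming (_∈_ to _∈ₗ_)
open import Data.Product using (Σ; ∃; _×_; _,_)
open import Relation.Binary.PropositionalEquality using (_≡_; _≢_)

-- A hypergraph on the finite vertex set V = Fin n: a list of distinct edges,
-- each edge a subset of Fin n.  (E ⊂ 2^V is a set, hence no repeated edges.)
record Hypergraph : Set where
  constructor hypergraph
  field
    n        : ℕ
    edges    : List (Subset n)
    distinct : Unique edges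
open Hypergraph public

degree : (H : Hypergraph) → Fin (n H) → ℕ
degree H v = length (filter (v ∈?_) (edges H))

maxDegree : Hypergraph → ℕ
maxDegree H = foldr _⊔_ 0 (map (degree H) (allFin (n H)))

-- minimum of a list of naturals (0 for the empty list; unused then)
minList : List ℕ → ℕ
minList []       = 0
minList (x ∷ xs) = foldr _⊓_ x xs

minEdgeSize : Hypergraph → ℕ
minEdgeSize H = minList (map ∣_∣ (edges H))

-- ceiling division ⌈ a / b ⌉ (b = 0 gives 0 by convention; never used here)
⌈_/_⌉ : ℕ → ℕ → ℕ
⌈ a / zero ⌉  = 0
⌈ a / suc b ⌉ = (a + b) / suc b

Proper : (H : Hypergraph) → (Fin (n H) → ℕ) → Set
Proper H c = All (λ e → Σ (Fin (n H)) λ u → Σ (Fin (n H)) λ w →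
                         u ∈ e × w ∈ e × c u ≢ c w) (edges H)

TwoColorable : Hypergraph → Set
TwoColorable H = Σ (Fin (n H) → ℕ) λ c →
  ((v : Fin (n H)) → c v ≤ 1) × Proper H c

Choosable : Hypergraph → ℕ → Set
Choosable H k = (L : Fin (n H) → List ℕ) →
  ((v : Fin (n H)) → length (L v) ≡ k × Unique (L v)) →
  Σ (Fin (n H) → ℕ) λ c → ((v : Fin (n H)) → c v ∈ₗ L v) × Proper H c

-- ch(H) ≤ m : the minimum k such that H is k-choosable is at most m,
-- i.e. some k ≤ m makes H k-choosable
ChoiceNumber≤ : Hypergraph → ℕ → Set
ChoiceNumber≤ H m = ∃ λ k → k ≤ m × Choosable H k

-- Let s be the minimum edge size and d = ⌈Δ/s⌉, so every degree is at most d·s.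
-- First choose in every edge a "tail" vertex so that each vertex is the tail of at most d edges:
-- starting from any choice, move tails along alternating walks from an overloaded to an underloaded
-- vertex; if no such walk exists, the vertices reachable from an overloaded one form a closed set R,
-- and double counting the edges with tail in R (each has at least s vertices, all in R) contradicts
-- deg ≤ d·s.  Then join each tail to a vertex of its edge of the other colour of a proper 2-colouring.
-- The resulting digraph is bipartite, hence every induced subdigraph has a kernel, and has
-- out-degrees at most d, so the kernel method colours it from any lists of size d + 1; a proper
-- colouring of this digraph is proper on every edge of the hypergraph.

module Submission where

open import Defs
open import Data.Bool using (true; false; if_then_else_)
open import Data.Fin using (Fin; zero; suc; _≟_)
open import Data.Fin.Properties using (any?; ¬∀⟶∃¬)
open import Data.Fin.Subset using (Subset; _∈_; _∉_; _⊆_; ∣_∣; ⊥; ⊤; _∪_; ⁅_⁆; Nonempty)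
open import Data.Fin.Subset.Properties
  using (_∈?_; _⊆?_; nonempty?; ∈⊤; ⊥⊆; p⊆p∪q; x∈p∪q⁺; x∈p∪q⁻; x∈⁅x⁆; x∈⁅y⁆⇒x≡y; Empty-unique;
         ∣p∣≤n; ∣⊥∣≡0; ∣⁅x⁆∣≡1; p⊆q⇒∣p∣≤∣q∣; p⊂q⇒∣p∣<∣q∣)
open import Data.List using (List; []; _∷_; length; filter; lookup; map; foldr)
open import Data.List.Properties
  using (filter-all; filter-accept; filter-reject; foldr-preservesᵇ; foldr-preservesᵒ)
open import Data.List.Relation.Unary.All as All using (All; _∷_)
open import Data.List.Relation.Unary.All.Properties using (¬Any⇒All¬) renaming (map⁺ to All-map⁺)
open import Data.List.Relation.Unary.AllPairs using ([]; _∷_)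
open import Data.List.Relation.Unary.Any as Any using (Any; here; there; index)
open import Data.List.Relation.Unary.Any.Properties using (lookup-index)
open import Data.List.Relation.Unary.Unique.Propositional using (Unique)
open import Data.List.Relation.Unary.Unique.Propositional.Properties using (filter⁺)
open import Data.List.Membership.Propositional using () renaming (_∈_ to _∈ₗ_; _∉_ to _∉ₗ_)
open import Data.List.Membership.Propositional.Properties using (∈-filter⁻; ∈-lookup; ∈-map⁺; ∈-allFin)
open import Data.Nat
  using (ℕ; zero; suc; _+_; _*_; _∸_; _⊔_; _⊓_; _≤_; _<_; z≤n; s≤s; s≤s⁻¹; z<s; _≤?_; _<?_;
         NonZero; >-nonZero; >-nonZero⁻¹)
import Data.Nat as ℕ
open import Data.Nat.DivMod using (_/_; _%_; m≡m%n+[m/n]*n; m%n<n)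
open import Data.Nat.Induction using (<-wellFounded)
open import Data.Nat.Properties hiding (_≟_)
open import Algebra.Properties.Semiring.Sum +-*-semiring
  using (sum; sum-syntax; sum-cong-≗; sum-replicate-zero; ∑-distrib-+; ∑-comm; *-distribˡ-sum; *-distribʳ-sum)
open import Data.List.Membership.DecPropositional ℕ._≟_ using () renaming (_∈?_ to _∈ₗ?_)
open import Data.Product using (Σ; ∃; _×_; _,_; proj₁; proj₂; map₂)
open import Data.Sum using (_⊎_; inj₁; inj₂; [_,_]; reduce)
open import Data.Vec using (tabulate) renaming ([] to []ᵥ; _∷_ to _∷ᵥ_)
open import Data.Vec.Properties using (lookup∘tabulate; lookup⇒[]=; []=⇒lookup)
open import Data.Vec.Functional using (updateAt)
open import Data.Vec.Functional.Properties using (updateAt-updates; updateAt-minimal)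
open import Function using (_∘_; const)
open import Induction.WellFounded using (Acc; acc)
open import Relation.Binary.PropositionalEquality
  using (_≡_; _≢_; refl; sym; trans; cong; cong₂; subst; ≢-sym; module ≡-Reasoning)
open import Relation.Nullary using (Dec; yes; no; does; ¬_; contradiction)
open import Relation.Nullary.Decidable using (dec-true; dec-false; _→-dec_; _×-dec_; ¬?)
open import Relation.Unary using (Pred; Decidable)

𝟙[_] : ∀ {a} {A : Set a} → Dec A → ℕ
𝟙[ d ] = if does d then 1 else 0

𝟙≤1 : ∀ {a} {A : Set a} (d : Dec A) → 𝟙[ d ] ≤ 1
𝟙≤1 (yes _) = s≤s z≤n
𝟙≤1 (no _)  = z≤n

𝟙-yes : ∀ {a} {A : Set a} (a? : Dec A) → A → 𝟙[ a? ] ≡ 1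
𝟙-yes a? a rewrite dec-true a? a = refl

𝟙-no : ∀ {a} {A : Set a} (a? : Dec A) → ¬ A → 𝟙[ a? ] ≡ 0
𝟙-no a? ¬a rewrite dec-false a? ¬a = refl

suc-∸ : ∀ x d → suc x ∸ d ≡ (x ∸ d) + 𝟙[ d ≤? x ]
suc-∸ x d with d ≤? x
... | yes d≤x = begin
  suc x ∸ d                ≡⟨ +-∸-assoc 1 d≤x ⟩
  suc (x ∸ d)              ≡⟨ +-comm 1 _ ⟩
  (x ∸ d) + 1              ≡⟨ cong ((x ∸ d) +_) (𝟙-yes (d ≤? x) d≤x) ⟨
  (x ∸ d) + 𝟙[ d ≤? x ]    ∎
  where open ≡-Reasoning
... | no  d≰x = begin
  suc x ∸ d                ≡⟨ m≤n⇒m∸n≡0 (≰⇒> d≰x) ⟩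
  0                        ≡⟨ cong₂ _+_ (m≤n⇒m∸n≡0 (<⇒≤ (≰⇒> d≰x))) (𝟙-no (d ≤? x) d≰x) ⟨
  (x ∸ d) + 𝟙[ d ≤? x ]    ∎
  where open ≡-Reasoning

𝟙-mono : ∀ {a b} {A : Set a} {B : Set b} → (A → B) → (a? : Dec A) (b? : Dec B) → 𝟙[ a? ] ≤ 𝟙[ b? ]
𝟙-mono A⇒B (yes a) (yes _) = ≤-refl
𝟙-mono A⇒B (yes a) (no ¬b) = contradiction (A⇒B a) ¬b
𝟙-mono A⇒B (no _)  _       = z≤n

sum-mono-≤ : ∀ {n} {f g : Fin n → ℕ} → (∀ i → f i ≤ g i) → sum f ≤ sum g
sum-mono-≤ {zero}  f≤g = z≤n
sum-mono-≤ {suc n} f≤g = +-mono-≤ (f≤g zero) (sum-mono-≤ (f≤g ∘ suc))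

sum-mono-< : ∀ {n} {f g : Fin n → ℕ} → (∀ i → f i ≤ g i) → ∀ j → f j < g j → sum f < sum g
sum-mono-< f≤g zero    fj<gj = +-mono-<-≤ fj<gj (sum-mono-≤ (f≤g ∘ suc))
sum-mono-< f≤g (suc j) fj<gj = +-mono-≤-< (f≤g zero) (sum-mono-< (f≤g ∘ suc) j fj<gj)

sum-δ : ∀ {n} (i : Fin n) (f : Fin n → ℕ) → ∑[ j < n ] (𝟙[ i ≟ j ] * f j) ≡ f i
sum-δ {suc n} zero    f =
  trans (cong (f zero + 0 +_) (sum-replicate-zero n)) (trans (+-identityʳ _) (+-identityʳ _))
sum-δ {suc n} (suc i) f = sum-δ i (f ∘ suc)

sum-transfer : ∀ {n} (f g : Fin n → ℕ) (i j : Fin n) (x y : ℕ) →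
               (∀ k → f k + 𝟙[ i ≟ k ] * x ≡ g k + 𝟙[ j ≟ k ] * y) → sum f + x ≡ sum g + y
sum-transfer f g i j x y pointwise = begin
  sum f + x                             ≡⟨ cong (sum f +_) (sym (sum-δ i (λ _ → x))) ⟩
  sum f + ∑[ k < _ ] (𝟙[ i ≟ k ] * x)    ≡⟨ sym (∑-distrib-+ f _) ⟩
  ∑[ k < _ ] (f k + 𝟙[ i ≟ k ] * x)      ≡⟨ sum-cong-≗ pointwise ⟩
  ∑[ k < _ ] (g k + 𝟙[ j ≟ k ] * y)      ≡⟨ ∑-distrib-+ g _ ⟩
  sum g + ∑[ k < _ ] (𝟙[ j ≟ k ] * y)    ≡⟨ cong (sum g +_) (sum-δ j (λ _ → y)) ⟩
  sum g + y                             ∎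
  where open ≡-Reasoning

∣p∣≡∑𝟙[∈] : ∀ {n} (p : Subset n) → ∣ p ∣ ≡ ∑[ v < n ] 𝟙[ v ∈? p ]
∣p∣≡∑𝟙[∈] []ᵥ           = refl
∣p∣≡∑𝟙[∈] (true  ∷ᵥ p) = cong suc (∣p∣≡∑𝟙[∈] p)
∣p∣≡∑𝟙[∈] (false ∷ᵥ p) = ∣p∣≡∑𝟙[∈] p

subsetOf : ∀ {n p} {P : Pred (Fin n) p} → Decidable P → Subset n
subsetOf P? = tabulate (does ∘ P?)

module _ {n p} {P : Pred (Fin n) p} (P? : Decidable P) where

  ∈-subsetOf⁺ : ∀ {v} → P v → v ∈ subsetOf P?
  ∈-subsetOf⁺ {v} pv = lookup⇒[]= v _ (trans (lookup∘tabulate _ v) (dec-true (P? v) pv))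

  ∈-subsetOf⁻ : ∀ {v} → v ∈ subsetOf P? → P v
  ∈-subsetOf⁻ {v} v∈ = decided (P? v) (trans (sym (lookup∘tabulate _ v)) ([]=⇒lookup v∈))
    where
    decided : ∀ {A : Set p} (a? : Dec A) → does a? ≡ true → A
    decided (yes a) _ = a

⊈⇒∃∈∉ : ∀ {n} {p q : Subset n} → ¬ p ⊆ q → ∃ λ x → x ∈ p × x ∉ q
⊈⇒∃∈∉ {n} {p} {q} p⊈q with ¬∀⟶∃¬ n (λ x → x ∈ p → x ∈ q) (λ x → x ∈? p →-dec x ∈? q) (λ p⊆q → p⊈q (p⊆q _))
... | x , x∉ with x ∈? p
...   | yes x∈p = x , x∈p , λ x∈q → x∉ (λ _ → x∈q)
...   | no  x∉p = contradiction (λ x∈p → contradiction x∈p x∉p) x∉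

⊆-chain-stabilises : ∀ {n} (Y : ℕ → Subset n) → (∀ k → Y k ⊆ Y (suc k)) → ∃ λ k → Y (suc k) ⊆ Y k
⊆-chain-stabilises {n} Y Y↑ = go n 0 (m≤m+n n _)
  where
  go : ∀ room k → n ≤ room + ∣ Y k ∣ → ∃ λ k → Y (suc k) ⊆ Y k
  go room k bound with Y (suc k) ⊆? Y k
  ... | yes stable = k , stable
  ... | no unstable with p⊂q⇒∣p∣<∣q∣ (Y↑ k , ⊈⇒∃∈∉ unstable)
  go zero       k bound | no _ | grows = contradiction (≤-trans (∣p∣≤n (Y (suc k))) bound) (<⇒≱ grows)
  go (suc room) k bound | no _ | grows =
    go room (suc k) (≤-trans bound (≤-trans (≤-reflexive (sym (+-suc room _))) (+-monoʳ-≤ room grows)))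

_≢?_ : (α y : ℕ) → Dec (α ≢ y)
α ≢? y = ¬? (α ℕ.≟ y)

remove : ℕ → List ℕ → List ℕ
remove α = filter (α ≢?_)

nonempty-member : ∀ {a} {A : Set a} (xs : List A) → 0 < length xs → ∃ (_∈ₗ xs)
nonempty-member (x ∷ _) _ = x , here refl

remove-∉ : ∀ {α} xs → α ∉ₗ xs → remove α xs ≡ xs
remove-∉ {α} xs α∉xs = filter-all (α ≢?_) (¬Any⇒All¬ xs α∉xs)

length≤suc-length-remove : ∀ α {xs} → Unique xs → length xs ≤ suc (length (remove α xs))
length≤suc-length-remove α {[]}     []              = z≤n
length≤suc-length-remove α {x ∷ xs} (x∉xs ∷ unique) with α ℕ.≟ x
... | yes refl = begin
  suc (length xs)                   ≡⟨ cong (suc ∘ length) (filter-all (α ≢?_) x∉xs) ⟨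
  suc (length (remove α xs))        ≡⟨ cong (suc ∘ length) (filter-reject (α ≢?_) (λ α≢α → α≢α refl)) ⟨
  suc (length (remove α (α ∷ xs)))  ∎
  where open ≤-Reasoning
... | no  α≢x  = begin
  suc (length xs)                   ≤⟨ s≤s (length≤suc-length-remove α unique) ⟩
  suc (length (x ∷ remove α xs))    ≡⟨ cong (suc ∘ length) (filter-accept (α ≢?_) α≢x) ⟨
  suc (length (remove α (x ∷ xs)))  ∎
  where open ≤-Reasoning

-- Kernels and list colourings of bipartite digraphs

module Digraph {n m : ℕ} (tail head : Fin m → Fin n) where

  Independent : Subset n → Set
  Independent X = ∀ i → tail i ∈ X → head i ∉ X

  Bipartite : Subset n → Set
  Bipartite A = ∀ i → (tail i ∈ A → head i ∉ A) × (tail i ∉ A → head i ∈ A)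

  two-colouring⇒bipartite : (c : Fin n → ℕ) → (∀ v → c v ≤ 1) → (∀ i → c (tail i) ≢ c (head i)) →
                            Bipartite (subsetOf (λ v → c v ℕ.≟ 0))
  two-colouring⇒bipartite c c≤1 proper i =
      (λ t∈A h∈A → proper i (trans (∈-subsetOf⁻ zero? t∈A) (sym (∈-subsetOf⁻ zero? h∈A))))
    , (λ t∉A → ∈-subsetOf⁺ zero? (other-colour (c≤1 _) (c≤1 _) (proper i) (t∉A ∘ ∈-subsetOf⁺ zero?)))
    where
    zero? : ∀ v → Dec (c v ≡ 0)
    zero? v = c v ℕ.≟ 0
    other-colour : ∀ {x y} → x ≤ 1 → y ≤ 1 → x ≢ y → x ≢ 0 → y ≡ 0
    other-colour z≤n       _         _   x≢0 = contradiction refl x≢0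
    other-colour (s≤s z≤n) z≤n       _   _   = refl
    other-colour (s≤s z≤n) (s≤s z≤n) x≢y _   = contradiction refl x≢y

  ArcInto : Subset n → Fin n → Set
  ArcInto Y v = ∃ λ i → tail i ≡ v × head i ∈ Y

  arcInto? : ∀ Y → Decidable (ArcInto Y)
  arcInto? Y v = any? (λ i → tail i ≟ v ×-dec head i ∈? Y)

  arcInto-mono : ∀ {Y Y' v} → Y ⊆ Y' → ArcInto Y v → ArcInto Y' v
  arcInto-mono Y⊆Y' (i , tail≡v , head∈Y) = i , tail≡v , Y⊆Y' head∈Y

  record Kernel (S : Subset n) : Set where
    field
      K           : Subset n
      K⊆S         : K ⊆ S
      independent : Independent K
      absorbing   : ∀ {v} → v ∈ S → v ∉ K → ArcInto K v

  -- For a fixed point Y of the monotone map F, the set K = X Y ∪ Y is a kernel of S: a vertex of S ∩ A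
  -- outside K has an arc into Y, and one of S ∖ A outside K has an arc into X Y.
  module KernelConstruction {A : Subset n} (bip : Bipartite A) (S : Subset n) where

    InX : Subset n → Fin n → Set
    InX Y v = v ∈ S × v ∈ A × ¬ ArcInto Y v

    InX? : ∀ Y → Decidable (InX Y)
    InX? Y v = v ∈? S ×-dec v ∈? A ×-dec ¬? (arcInto? Y v)

    X : Subset n → Subset n
    X Y = subsetOf (InX? Y)

    InF : Subset n → Fin n → Set
    InF Y v = v ∈ S × v ∉ A × ¬ ArcInto (X Y) v

    InF? : ∀ Y → Decidable (InF Y)
    InF? Y v = v ∈? S ×-dec ¬? (v ∈? A) ×-dec ¬? (arcInto? (X Y) v)

    F : Subset n → Subset n
    F Y = subsetOf (InF? Y)

    X-antitone : ∀ {Y Y'} → Y ⊆ Y' → X Y' ⊆ X Y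
    X-antitone Y⊆Y' v∈XY' with ∈-subsetOf⁻ (InX? _) v∈XY'
    ... | v∈S , v∈A , noArc = ∈-subsetOf⁺ (InX? _) (v∈S , v∈A , noArc ∘ arcInto-mono Y⊆Y')

    F-monotone : ∀ {Y Y'} → Y ⊆ Y' → F Y ⊆ F Y'
    F-monotone Y⊆Y' v∈FY with ∈-subsetOf⁻ (InF? _) v∈FY
    ... | v∈S , v∉A , noArc = ∈-subsetOf⁺ (InF? _) (v∈S , v∉A , noArc ∘ arcInto-mono (X-antitone Y⊆Y'))

    iterate : ℕ → Subset n
    iterate zero    = ⊥
    iterate (suc k) = F (iterate k)

    iterate-increasing : ∀ k → iterate k ⊆ iterate (suc k)
    iterate-increasing zero    = ⊥⊆
    iterate-increasing (suc k) = F-monotone (iterate-increasing k)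

    stage : ℕ
    stage = proj₁ (⊆-chain-stabilises iterate iterate-increasing)

    Y : Subset n
    Y = iterate stage

    Y⊆FY : Y ⊆ F Y
    Y⊆FY = iterate-increasing stage

    FY⊆Y : F Y ⊆ Y
    FY⊆Y = proj₂ (⊆-chain-stabilises iterate iterate-increasing)

    K : Subset n
    K = X Y ∪ Y

    K⊆S : K ⊆ S
    K⊆S v∈K with x∈p∪q⁻ (X Y) Y v∈K
    ... | inj₁ v∈XY = proj₁ (∈-subsetOf⁻ (InX? Y) v∈XY)
    ... | inj₂ v∈Y  = proj₁ (∈-subsetOf⁻ (InF? Y) (Y⊆FY v∈Y))

    XY⊆A : X Y ⊆ A
    XY⊆A = proj₁ ∘ proj₂ ∘ ∈-subsetOf⁻ (InX? Y)

    XY-noArc : ∀ {v} → v ∈ X Y → ¬ ArcInto Y v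
    XY-noArc = proj₂ ∘ proj₂ ∘ ∈-subsetOf⁻ (InX? Y)

    ∈Y⇒∉A : ∀ {v} → v ∈ Y → v ∉ A
    ∈Y⇒∉A = proj₁ ∘ proj₂ ∘ ∈-subsetOf⁻ (InF? Y) ∘ Y⊆FY

    Y-noArc : ∀ {v} → v ∈ Y → ¬ ArcInto (X Y) v
    Y-noArc = proj₂ ∘ proj₂ ∘ ∈-subsetOf⁻ (InF? Y) ∘ Y⊆FY

    independent : Independent K
    independent i t∈K h∈K with x∈p∪q⁻ (X Y) Y t∈K | x∈p∪q⁻ (X Y) Y h∈K
    ... | inj₁ t∈XY | inj₁ h∈XY = proj₁ (bip i) (XY⊆A t∈XY) (XY⊆A h∈XY)
    ... | inj₁ t∈XY | inj₂ h∈Y  = XY-noArc t∈XY (i , refl , h∈Y)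
    ... | inj₂ t∈Y  | inj₁ h∈XY = Y-noArc t∈Y (i , refl , h∈XY)
    ... | inj₂ t∈Y  | inj₂ h∈Y  = ∈Y⇒∉A h∈Y (proj₂ (bip i) (∈Y⇒∉A t∈Y))

    absorbing : ∀ {v} → v ∈ S → v ∉ K → ArcInto K v
    absorbing {v} v∈S v∉K with v ∈? A
    ... | yes v∈A with arcInto? Y v
    ...   | yes arc  = arcInto-mono (λ w∈Y → x∈p∪q⁺ (inj₂ w∈Y)) arc
    ...   | no noArc = contradiction (x∈p∪q⁺ (inj₁ (∈-subsetOf⁺ (InX? Y) (v∈S , v∈A , noArc)))) v∉K
    absorbing {v} v∈S v∉K | no v∉A with arcInto? (X Y) v
    ...   | yes arc  = arcInto-mono (λ w∈XY → x∈p∪q⁺ (inj₁ w∈XY)) arc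
    ...   | no noArc = contradiction (x∈p∪q⁺ (inj₂ (FY⊆Y (∈-subsetOf⁺ (InF? Y) (v∈S , v∉A , noArc))))) v∉K

  bipartite⇒kernel : ∀ {A} → Bipartite A → (S : Subset n) → Kernel S
  bipartite⇒kernel bip S = record { KernelConstruction bip S }

  outdegIn : Subset n → Fin n → ℕ
  outdegIn U v = ∑[ i < m ] (𝟙[ tail i ≟ v ] * 𝟙[ head i ∈? U ])

  outdeg : Fin n → ℕ
  outdeg v = ∑[ i < m ] 𝟙[ tail i ≟ v ]

  outdegIn≤outdeg : ∀ U v → outdegIn U v ≤ outdeg v
  outdegIn≤outdeg U v =
    sum-mono-≤ (λ i → ≤-trans (*-monoʳ-≤ 𝟙[ tail i ≟ v ] (𝟙≤1 (head i ∈? U))) (≤-reflexive (*-identityʳ _)))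

  arc-mono : ∀ {U' U} v → U' ⊆ U →
             ∀ i → 𝟙[ tail i ≟ v ] * 𝟙[ head i ∈? U' ] ≤ 𝟙[ tail i ≟ v ] * 𝟙[ head i ∈? U ]
  arc-mono v U'⊆U i = *-monoʳ-≤ 𝟙[ tail i ≟ v ] (𝟙-mono U'⊆U (head i ∈? _) (head i ∈? _))

  outdegIn-mono : ∀ {U' U} v → U' ⊆ U → outdegIn U' v ≤ outdegIn U v
  outdegIn-mono v U'⊆U = sum-mono-≤ (arc-mono v U'⊆U)

  outdegIn-mono-< : ∀ {U' U v} → U' ⊆ U → (i : Fin m) → tail i ≡ v → head i ∈ U → head i ∉ U' →
                    outdegIn U' v < outdegIn U v
  outdegIn-mono-< {U'} {U} U'⊆U i refl h∈U h∉U' = sum-mono-< (arc-mono (tail i) U'⊆U) i arc-i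
    where
    arc-i : 𝟙[ tail i ≟ tail i ] * 𝟙[ head i ∈? U' ] < 𝟙[ tail i ≟ tail i ] * 𝟙[ head i ∈? U ]
    arc-i rewrite dec-true (tail i ≟ tail i) refl | dec-false (head i ∈? U') h∉U' | dec-true (head i ∈? U) h∈U =
      s≤s z≤n

  ListColouring : (Fin n → List ℕ) → Subset n → (Fin n → ℕ) → Set
  ListColouring L U c =
    (∀ {v} → v ∈ U → c v ∈ₗ L v) × (∀ i → tail i ∈ U → head i ∈ U → c (tail i) ≢ c (head i))

  -- One round of the kernel method: colour with α a kernel K of the vertices of U whose lists contain α,
  -- then delete K from U and α from the remaining lists.
  module KernelRound {A : Subset n} (bip : Bipartite A) (L : Fin n → List ℕ) (U : Subset n) (α : ℕ) where

    InS : Fin n → Set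
    InS v = v ∈ U × α ∈ₗ L v

    InS? : Decidable InS
    InS? v = v ∈? U ×-dec α ∈ₗ? L v

    open Kernel (bipartite⇒kernel bip (subsetOf InS?))

    InU' : Fin n → Set
    InU' v = v ∈ U × v ∉ K

    InU'? : Decidable InU'
    InU'? v = v ∈? U ×-dec ¬? (v ∈? K)

    U' : Subset n
    U' = subsetOf InU'?

    L' : Fin n → List ℕ
    L' v = remove α (L v)

    K⊆U : K ⊆ U
    K⊆U = proj₁ ∘ ∈-subsetOf⁻ InS? ∘ K⊆S

    U'⊆U : U' ⊆ U
    U'⊆U = proj₁ ∘ ∈-subsetOf⁻ InU'?

    ∈K⇒∉U' : ∀ {v} → v ∈ K → v ∉ U'
    ∈K⇒∉U' v∈K v∈U' = proj₂ (∈-subsetOf⁻ InU'? v∈U') v∈K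

    K-nonempty : ∀ {u} → u ∈ U → α ∈ₗ L u → Nonempty K
    K-nonempty {u} u∈U α∈Lu with u ∈? K
    ... | yes u∈K = u , u∈K
    ... | no  u∉K with absorbing (∈-subsetOf⁺ InS? (u∈U , α∈Lu)) u∉K
    ...   | i , _ , head∈K = head i , head∈K

    shrinks : ∀ {u} → u ∈ U → α ∈ₗ L u → ∣ U' ∣ < ∣ U ∣
    shrinks u∈U α∈Lu with K-nonempty u∈U α∈Lu
    ... | w , w∈K = p⊂q⇒∣p∣<∣q∣ (U'⊆U , w , K⊆U w∈K , ∈K⇒∉U' w∈K)

    bounded : (∀ v → Unique (L v)) → (∀ {v} → v ∈ U → outdegIn U v < length (L v)) →
              ∀ {v} → v ∈ U' → outdegIn U' v < length (L' v)
    bounded unique bound {v} v∈U' with ∈-subsetOf⁻ InU'? v∈U' | α ∈ₗ? L v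
    ... | v∈U , _ | no α∉Lv = begin-strict
      outdegIn U' v      ≤⟨ outdegIn-mono v U'⊆U ⟩
      outdegIn U v       <⟨ bound v∈U ⟩
      length (L v)       ≡⟨ cong length (remove-∉ (L v) α∉Lv) ⟨
      length (L' v)      ∎
      where open ≤-Reasoning
    ... | v∈U , v∉K | yes α∈Lv with absorbing (∈-subsetOf⁺ InS? (v∈U , α∈Lv)) v∉K
    ...   | i , tail≡v , head∈K = s≤s⁻¹ (begin-strict
      suc (outdegIn U' v)    ≤⟨ outdegIn-mono-< U'⊆U i tail≡v (K⊆U head∈K) (∈K⇒∉U' head∈K) ⟩
      outdegIn U v           <⟨ bound v∈U ⟩
      length (L v)           ≤⟨ length≤suc-length-remove α (unique v) ⟩
      suc (length (L' v))    ∎)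
      where open ≤-Reasoning

    extend : (Fin n → ℕ) → Fin n → ℕ
    extend c' v = if does (v ∈? K) then α else c' v

    extend-colouring : ∀ {c'} → ListColouring L' U' c' → ListColouring L U (extend c')
    extend-colouring {c'} (c'∈L' , c'-proper) = ∈L , proper
      where
      ∈U' : ∀ {v} → v ∈ U → v ∉ K → v ∈ U'
      ∈U' v∈U v∉K = ∈-subsetOf⁺ InU'? (v∈U , v∉K)
      α≢c' : ∀ {v} → v ∈ U → v ∉ K → α ≢ c' v
      α≢c' {v} v∈U v∉K = proj₂ (∈-filter⁻ (α ≢?_) {xs = L v} (c'∈L' (∈U' v∈U v∉K)))
      ∈L : ∀ {v} → v ∈ U → extend c' v ∈ₗ L v
      ∈L {v} v∈U with v ∈? K
      ... | yes v∈K = proj₂ (∈-subsetOf⁻ InS? (K⊆S v∈K))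
      ... | no  v∉K = proj₁ (∈-filter⁻ (α ≢?_) {xs = L v} (c'∈L' (∈U' v∈U v∉K)))
      proper : ∀ i → tail i ∈ U → head i ∈ U → extend c' (tail i) ≢ extend c' (head i)
      proper i t∈U h∈U with tail i ∈? K | head i ∈? K
      ... | yes t∈K | yes h∈K = contradiction h∈K (independent i t∈K)
      ... | yes _   | no  h∉K = α≢c' h∈U h∉K
      ... | no  t∉K | yes _   = α≢c' t∈U t∉K ∘ sym
      ... | no  t∉K | no  h∉K = c'-proper i (∈U' t∈U t∉K) (∈U' h∈U h∉K)

  bipartite⇒list-colourable : ∀ {A} → Bipartite A → (L : Fin n → List ℕ) → (∀ v → Unique (L v)) →
                              ∀ U → (∀ {v} → v ∈ U → outdegIn U v < length (L v)) → ∃ (ListColouring L U)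
  bipartite⇒list-colourable bip L unique U = colour L unique U (<-wellFounded ∣ U ∣)
    where
    colour : ∀ L → (∀ v → Unique (L v)) → ∀ U → Acc _<_ ∣ U ∣ →
             (∀ {v} → v ∈ U → outdegIn U v < length (L v)) → ∃ (ListColouring L U)
    colour L unique U (acc smaller) bound with nonempty? U
    ... | no empty =
      (λ _ → 0) , (λ {v} v∈U → contradiction (v , v∈U) empty) , (λ i t∈U _ → contradiction (tail i , t∈U) empty)
    ... | yes (u , u∈U) with nonempty-member (L u) (≤-<-trans z≤n (bound u∈U))
    ...   | α , α∈Lu
      with colour L' (λ v → filter⁺ (α ≢?_) (unique v)) U' (smaller (shrinks u∈U α∈Lu)) (bounded unique bound)
      where open KernelRound bip L U α
    ...     | c' , colouring' = extend c' , extend-colouring colouring'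
      where open KernelRound bip L U α

-- Orientations of hypergraphs with bounded load

Bichromatic : ∀ {n} → (Fin n → ℕ) → Subset n → Set
Bichromatic {n} c e = Σ (Fin n) λ u → Σ (Fin n) λ w → u ∈ e × w ∈ e × c u ≢ c w

differently-coloured : ∀ {n} (c : Fin n → ℕ) (t : Fin n) {e : Subset n} → Bichromatic c e →
                       Σ (Fin n) λ h → h ∈ e × c t ≢ c h
differently-coloured c t (u , w , u∈e , w∈e , cu≢cw) with c t ℕ.≟ c u
... | yes ct≡cu = w , w∈e , λ ct≡cw → cu≢cw (trans (sym ct≡cu) ct≡cw)
... | no  ct≢cu = u , u∈e , ct≢cu

module Orientation {n m : ℕ} (E : Fin m → Subset n) where

  -- σ i is the vertex of edge i chosen as the tail of its arc.
  Assignment : Set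
  Assignment = Fin m → Fin n

  Valid : Assignment → Set
  Valid σ = ∀ i → σ i ∈ E i

  load : Assignment → Fin n → ℕ
  load σ v = ∑[ i < m ] 𝟙[ σ i ≟ v ]

  deg : Fin n → ℕ
  deg v = ∑[ i < m ] 𝟙[ v ∈? E i ]

  reassign : Assignment → Fin m → Fin n → Assignment
  reassign σ i b = updateAt σ i (const b)

  reassign-valid : ∀ {σ} i {b} → Valid σ → b ∈ E i → Valid (reassign σ i b)
  reassign-valid {σ} i V b∈Ei j with i ≟ j
  ... | yes refl = subst (_∈ E i) (sym (updateAt-updates i σ)) b∈Ei
  ... | no  i≢j  = subst (_∈ E j) (sym (updateAt-minimal j i σ (i≢j ∘ sym))) (V j)

  module Reassign (σ : Assignment) (i : Fin m) {a : Fin n} (σi≡a : σ i ≡ a) (b : Fin n) where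

    σ' : Assignment
    σ' = reassign σ i b

    load-reassign : ∀ v → load σ' v + 𝟙[ a ≟ v ] ≡ load σ v + 𝟙[ b ≟ v ]
    load-reassign v = sum-transfer _ _ i i 𝟙[ a ≟ v ] 𝟙[ b ≟ v ] pointwise
      where
      pointwise : ∀ j → 𝟙[ σ' j ≟ v ] + 𝟙[ i ≟ j ] * 𝟙[ a ≟ v ] ≡ 𝟙[ σ j ≟ v ] + 𝟙[ i ≟ j ] * 𝟙[ b ≟ v ]
      pointwise j with i ≟ j
      ... | yes refl
        rewrite updateAt-updates i {const b} σ | σi≡a | *-identityˡ 𝟙[ a ≟ v ] | *-identityˡ 𝟙[ b ≟ v ] =
        +-comm 𝟙[ b ≟ v ] 𝟙[ a ≟ v ]
      ... | no  i≢j  = cong (λ w → 𝟙[ w ≟ v ] + 0) (updateAt-minimal j i σ (i≢j ∘ sym))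

    module _ (a≢b : a ≢ b) where

      load-source : load σ a ≡ suc (load σ' a)
      load-source = begin
        load σ a                   ≡⟨ +-identityʳ _ ⟨
        load σ a + 0               ≡⟨ cong (load σ a +_) (𝟙-no (b ≟ a) (a≢b ∘ sym)) ⟨
        load σ a + 𝟙[ b ≟ a ]      ≡⟨ load-reassign a ⟨
        load σ' a + 𝟙[ a ≟ a ]     ≡⟨ cong (load σ' a +_) (𝟙-yes (a ≟ a) refl) ⟩
        load σ' a + 1              ≡⟨ +-comm _ 1 ⟩
        suc (load σ' a)            ∎
        where open ≡-Reasoning

      load-target : load σ' b ≡ suc (load σ b)
      load-target = begin
        load σ' b                  ≡⟨ +-identityʳ _ ⟨
        load σ' b + 0              ≡⟨ cong (load σ' b +_) (𝟙-no (a ≟ b) a≢b) ⟨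
        load σ' b + 𝟙[ a ≟ b ]     ≡⟨ load-reassign b ⟩
        load σ b + 𝟙[ b ≟ b ]      ≡⟨ cong (load σ b +_) (𝟙-yes (b ≟ b) refl) ⟩
        load σ b + 1               ≡⟨ +-comm _ 1 ⟩
        suc (load σ b)             ∎
        where open ≡-Reasoning

    load-other : ∀ {v} → a ≢ v → b ≢ v → load σ' v ≡ load σ v
    load-other {v} a≢v b≢v = +-cancelʳ-≡ _ _ _ (begin
      load σ' v + 0              ≡⟨ cong (load σ' v +_) (𝟙-no (a ≟ v) a≢v) ⟨
      load σ' v + 𝟙[ a ≟ v ]     ≡⟨ load-reassign v ⟩
      load σ v + 𝟙[ b ≟ v ]      ≡⟨ cong (load σ v +_) (𝟙-no (b ≟ v) b≢v) ⟩
      load σ v + 0               ∎)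
      where open ≡-Reasoning

  -- The index k only bounds the length of the walk.
  data Walk (σ : Assignment) : ℕ → Fin n → Fin n → Set where
    []   : ∀ {k a} → Walk σ k a a
    step : ∀ {k a b t} i → σ i ≡ a → b ∈ E i → Walk σ k b t → Walk σ (suc k) a t

  weaken : ∀ {σ k a t} → Walk σ k a t → Walk σ (suc k) a t
  weaken []                = []
  weaken (step i e b∈Ei w) = step i e b∈Ei (weaken w)

  walk-snoc : ∀ {σ k a v} i → Walk σ k a (σ i) → v ∈ E i → Walk σ (suc k) a v
  walk-snoc i []                v∈Ei = step i refl v∈Ei []
  walk-snoc i (step j e b∈Ej w) v∈Ei = step j e b∈Ej (walk-snoc i w v∈Ei)

  -- The walk either avoids edge i, or its part after the last use of i starts at the new tail y.
  reassign-walk : ∀ {σ k a t} i y → Walk σ k a t → Walk (reassign σ i y) k a t ⊎ Walk (reassign σ i y) k y t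
  reassign-walk i y [] = inj₁ []
  reassign-walk {σ} i y (step j σj≡a b∈Ej w) with reassign-walk i y w | i ≟ j
  ... | inj₂ w' | _        = inj₂ (weaken w')
  ... | inj₁ w' | yes refl = inj₂ (step i (updateAt-updates i σ) b∈Ej w')
  ... | inj₁ w' | no  i≢j  = inj₁ (step j (trans (updateAt-minimal j i σ (i≢j ∘ sym)) σj≡a) b∈Ej w')

  Closed : Assignment → Subset n → Set
  Closed σ R = ∀ i → σ i ∈ R → E i ⊆ R

  module Reachable (σ : Assignment) (x : Fin n) where

    Step : Subset n → Fin n → Set
    Step Y v = ∃ λ i → σ i ∈ Y × v ∈ E i

    step? : ∀ Y → Decidable (Step Y)
    step? Y v = any? (λ i → σ i ∈? Y ×-dec v ∈? E i)

    ball : ℕ → Subset n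
    ball zero    = ⁅ x ⁆
    ball (suc k) = ball k ∪ subsetOf (step? (ball k))

    ball-increasing : ∀ k → ball k ⊆ ball (suc k)
    ball-increasing k = p⊆p∪q _

    x∈ball : ∀ k → x ∈ ball k
    x∈ball zero    = x∈⁅x⁆ x
    x∈ball (suc k) = ball-increasing k (x∈ball k)

    ball-walk : ∀ k {v} → v ∈ ball k → Walk σ k x v
    ball-walk zero    v∈ball with x∈⁅y⁆⇒x≡y x v∈ball
    ... | refl = []
    ball-walk (suc k) v∈ball with x∈p∪q⁻ (ball k) _ v∈ball
    ... | inj₁ v∈ballₖ = weaken (ball-walk k v∈ballₖ)
    ... | inj₂ v∈step with ∈-subsetOf⁻ (step? (ball k)) v∈step
    ...   | i , σi∈ballₖ , v∈Ei = walk-snoc i (ball-walk k σi∈ballₖ) v∈Ei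

    radius : ℕ
    radius = proj₁ (⊆-chain-stabilises ball ball-increasing)

    reach : Subset n
    reach = ball radius

    reach-closed : Closed σ reach
    reach-closed i σi∈R v∈Ei = proj₂ (⊆-chain-stabilises ball ball-increasing)
                                      (x∈p∪q⁺ (inj₂ (∈-subsetOf⁺ (step? reach) (i , σi∈R , v∈Ei))))

  -- Counting the edges with tail in a closed set R twice: each has all its (at least s) vertices in R,
  -- and each vertex of R lies in at most d * s edges.
  closed-load-bound : ∀ {s d} .{{_ : NonZero s}} → (∀ i → s ≤ ∣ E i ∣) → (∀ v → deg v ≤ d * s) →
                      ∀ σ R → Closed σ R → ∑[ v < n ] (𝟙[ v ∈? R ] * load σ v) ≤ ∣ R ∣ * d
  closed-load-bound {s} {d} s≤∣E∣ deg≤ds σ R closed = *-cancelʳ-≤ _ _ s (begin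
    (∑[ v < n ] (r v * load σ v)) * s                 ≡⟨ cong (_* s) tails-in-R ⟩
    (∑[ i < m ] r (σ i)) * s                          ≡⟨ *-distribʳ-sum s (r ∘ σ) ⟩
    ∑[ i < m ] (r (σ i) * s)                          ≤⟨ sum-mono-≤ (λ i → *-monoʳ-≤ (r (σ i)) (s≤∣E∣ i)) ⟩
    ∑[ i < m ] (r (σ i) * ∣ E i ∣)                    ≡⟨ sum-cong-≗ (λ i → cong (r (σ i) *_) (∣p∣≡∑𝟙[∈] (E i))) ⟩
    ∑[ i < m ] (r (σ i) * ∑[ v < n ] e i v)           ≡⟨ sum-cong-≗ (λ i → *-distribˡ-sum (r (σ i)) (e i)) ⟩
    ∑[ i < m ] ∑[ v < n ] (r (σ i) * e i v)           ≡⟨ ∑-comm (λ i v → r (σ i) * e i v) ⟩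
    ∑[ v < n ] ∑[ i < m ] (r (σ i) * e i v)           ≤⟨ sum-mono-≤ (λ v → sum-mono-≤ (λ i → closed-term i v)) ⟩
    ∑[ v < n ] ∑[ i < m ] (r v * e i v)               ≡⟨ sum-cong-≗ (λ v → *-distribˡ-sum (r v) (λ i → e i v)) ⟨
    ∑[ v < n ] (r v * deg v)                          ≤⟨ sum-mono-≤ (λ v → *-monoʳ-≤ (r v) (deg≤ds v)) ⟩
    ∑[ v < n ] (r v * (d * s))                        ≡⟨ *-distribʳ-sum (d * s) r ⟨
    (∑[ v < n ] r v) * (d * s)                        ≡⟨ cong (_* (d * s)) (∣p∣≡∑𝟙[∈] R) ⟨
    ∣ R ∣ * (d * s)                                   ≡⟨ *-assoc ∣ R ∣ d s ⟨
    ∣ R ∣ * d * s                                     ∎)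
    where
    open ≤-Reasoning
    r : Fin n → ℕ
    r v = 𝟙[ v ∈? R ]
    e : Fin m → Fin n → ℕ
    e i v = 𝟙[ v ∈? E i ]
    tails-in-R : ∑[ v < n ] (r v * load σ v) ≡ ∑[ i < m ] r (σ i)
    tails-in-R = begin-equality
      ∑[ v < n ] (r v * load σ v)                     ≡⟨ sum-cong-≗ (λ v → *-distribˡ-sum (r v) (λ i → 𝟙[ σ i ≟ v ])) ⟩
      ∑[ v < n ] ∑[ i < m ] (r v * 𝟙[ σ i ≟ v ])      ≡⟨ ∑-comm (λ v i → r v * 𝟙[ σ i ≟ v ]) ⟩
      ∑[ i < m ] ∑[ v < n ] (r v * 𝟙[ σ i ≟ v ])      ≡⟨ sum-cong-≗ (λ i → trans (sum-cong-≗ (λ v → *-comm (r v) _))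
                                                                                  (sum-δ (σ i) r)) ⟩
      ∑[ i < m ] r (σ i)                              ∎
    closed-term : ∀ i v → r (σ i) * e i v ≤ r v * e i v
    closed-term i v with v ∈? E i
    ... | yes v∈Ei = *-monoˡ-≤ 1 (𝟙-mono (λ σi∈R → closed i σi∈R v∈Ei) (σ i ∈? R) (v ∈? R))
    ... | no  _    = ≤-reflexive (trans (*-zeroʳ (r (σ i))) (sym (*-zeroʳ (r v))))

  closed-not-overloaded : ∀ {s d} .{{_ : NonZero s}} → (∀ i → s ≤ ∣ E i ∣) → (∀ v → deg v ≤ d * s) →
                          ∀ σ R → Closed σ R → (∀ {v} → v ∈ R → d ≤ load σ v) → ∀ {x} → x ∈ R → load σ x ≤ d
  closed-not-overloaded {s} {d} s≤∣E∣ deg≤ds σ R closed full {x} x∈R =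
    ≮⇒≥ (λ over → <⇒≱ (total-over over) (closed-load-bound s≤∣E∣ deg≤ds σ R closed))
    where
    open ≤-Reasoning
    term-≤ : ∀ v → 𝟙[ v ∈? R ] * d ≤ 𝟙[ v ∈? R ] * load σ v
    term-≤ v with v ∈? R
    ... | yes v∈R = *-monoʳ-≤ 1 (full v∈R)
    ... | no  _   = z≤n
    term-< : d < load σ x → 𝟙[ x ∈? R ] * d < 𝟙[ x ∈? R ] * load σ x
    term-< over with x ∈? R
    ... | yes _   = *-monoʳ-< 1 over
    ... | no  x∉R = contradiction x∈R x∉R
    total-over : d < load σ x → ∣ R ∣ * d < ∑[ v < n ] (𝟙[ v ∈? R ] * load σ v)
    total-over over = begin-strict
      ∣ R ∣ * d                                  ≡⟨ cong (_* d) (∣p∣≡∑𝟙[∈] R) ⟩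
      (∑[ v < n ] 𝟙[ v ∈? R ]) * d               ≡⟨ *-distribʳ-sum d (λ v → 𝟙[ v ∈? R ]) ⟩
      ∑[ v < n ] (𝟙[ v ∈? R ] * d)               <⟨ sum-mono-< term-≤ x (term-< over) ⟩
      ∑[ v < n ] (𝟙[ v ∈? R ] * load σ v)        ∎

  module Balancing (d : ℕ) where

    excess : Assignment → ℕ
    excess σ = ∑[ v < n ] (load σ v ∸ d)

    excess-reassign : ∀ σ i {a} (σi≡a : σ i ≡ a) b → a ≢ b → d < load σ a →
                      excess (reassign σ i b) + 1 ≡ excess σ + 𝟙[ d ≤? load σ b ]
    excess-reassign σ i {a} σi≡a b a≢b over = sum-transfer _ _ a b 1 𝟙[ d ≤? load σ b ] pointwise
      where
      open Reassign σ i σi≡a b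
      pointwise : ∀ v → (load σ' v ∸ d) + 𝟙[ a ≟ v ] * 1 ≡ (load σ v ∸ d) + 𝟙[ b ≟ v ] * 𝟙[ d ≤? load σ b ]
      pointwise v with a ≟ v | b ≟ v
      ... | yes refl | yes refl = contradiction refl a≢b
      ... | yes refl | no  _    = begin
        (load σ' a ∸ d) + 1      ≡⟨ +-comm _ 1 ⟩
        suc (load σ' a ∸ d)      ≡⟨ +-∸-assoc 1 (s≤s⁻¹ (subst (d <_) (load-source a≢b) over)) ⟨
        suc (load σ' a) ∸ d      ≡⟨ cong (_∸ d) (load-source a≢b) ⟨
        load σ a ∸ d             ≡⟨ +-identityʳ _ ⟨
        (load σ a ∸ d) + 0       ∎
        where open ≡-Reasoning
      ... | no  _    | yes refl = begin
        (load σ' b ∸ d) + 0                         ≡⟨ +-identityʳ _ ⟩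
        load σ' b ∸ d                               ≡⟨ cong (_∸ d) (load-target a≢b) ⟩
        suc (load σ b) ∸ d                          ≡⟨ suc-∸ (load σ b) d ⟩
        (load σ b ∸ d) + 𝟙[ d ≤? load σ b ]         ≡⟨ cong ((load σ b ∸ d) +_) (*-identityˡ _) ⟨
        (load σ b ∸ d) + 1 * 𝟙[ d ≤? load σ b ]     ∎
        where open ≡-Reasoning
      ... | no a≢v | no b≢v = cong (λ l → (l ∸ d) + 0) (load-other a≢v b≢v)

    augment : ∀ k {σ a t} → Valid σ → Walk σ k a t → d < load σ a → load σ t < d →
              ∃ λ σ' → Valid σ' × excess σ' < excess σ
    augment k V [] over under = contradiction over (<-asym under)
    augment (suc k) {σ} {a} {t} V (step {b = b} i σi≡a b∈Ei w) over under with a ≟ b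
    ... | yes refl = augment k V w over under
    ... | no  a≢b  = shift (d ≤? load σ b)
      where
      open Reassign σ i σi≡a b
      V' : Valid σ'
      V' = reassign-valid i V b∈Ei
      excess-step : excess σ' + 1 ≡ excess σ + 𝟙[ d ≤? load σ b ]
      excess-step = excess-reassign σ i σi≡a b a≢b over
      shift : Dec (d ≤ load σ b) → ∃ λ σ'' → Valid σ'' × excess σ'' < excess σ
      shift (no d≰b) = σ' , V' , ≤-reflexive (begin
        suc (excess σ')                 ≡⟨ +-comm 1 _ ⟩
        excess σ' + 1                   ≡⟨ excess-step ⟩
        excess σ + 𝟙[ d ≤? load σ b ]   ≡⟨ cong (excess σ +_) (𝟙-no (d ≤? load σ b) d≰b) ⟩
        excess σ + 0                    ≡⟨ +-identityʳ _ ⟩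
        excess σ                        ∎)
        where open ≡-Reasoning
      shift (yes d≤b) with augment k V' (reduce (reassign-walk i b w)) b-over t-under
        where
        b-over : d < load σ' b
        b-over = subst (d <_) (sym (load-target a≢b)) (s≤s d≤b)
        t-under : load σ' t < d
        t-under = subst (_< d) (sym (load-other (λ { refl → <-asym over under }) (λ { refl → <⇒≱ under d≤b })))
                        under
      ... | σ'' , V'' , decreased = σ'' , V'' , <-≤-trans decreased (≤-reflexive excess-unchanged)
        where
        excess-unchanged : excess σ' ≡ excess σ
        excess-unchanged =
          +-cancelʳ-≡ _ _ _ (trans excess-step (cong (excess σ +_) (𝟙-yes (d ≤? load σ b) d≤b)))

    module _ {s} .{{_ : NonZero s}} (s≤∣E∣ : ∀ i → s ≤ ∣ E i ∣) (deg≤ds : ∀ v → deg v ≤ d * s) where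

      -- If no vertex reachable from the overloaded x is underloaded, reach is a closed set
      -- contradicting the counting bound.
      improve : ∀ {σ x} → Valid σ → d < load σ x → ∃ λ σ' → Valid σ' × excess σ' < excess σ
      improve {σ} {x} V over = search (any? (λ t → t ∈? reach ×-dec load σ t <? d))
        where
        open Reachable σ x
        search : Dec (∃ λ t → t ∈ reach × load σ t < d) → ∃ λ σ' → Valid σ' × excess σ' < excess σ
        search (yes (t , t∈R , under)) = augment radius V (ball-walk radius t∈R) over under
        search (no none) = contradiction over (≤⇒≯ (closed-not-overloaded s≤∣E∣ deg≤ds σ reach reach-closed
                             (λ v∈R → ≮⇒≥ (λ under → none (_ , v∈R , under))) (x∈ball radius)))

      balance : ∀ σ → Valid σ → Acc _<_ (excess σ) → ∃ λ σ' → Valid σ' × ∀ v → load σ' v ≤ d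
      balance σ V (acc smaller) with any? (λ v → d <? load σ v)
      ... | no  balanced    = σ , V , λ v → ≮⇒≥ (λ over → balanced (v , over))
      ... | yes (x , over) with improve V over
      ...   | σ' , V' , decreased = balance σ' V' (smaller decreased)

  orientation : ∀ {s d} .{{_ : NonZero s}} → (∀ i → s ≤ ∣ E i ∣) → (∀ v → deg v ≤ d * s) →
                ∃ λ σ → Valid σ × ∀ v → load σ v ≤ d
  orientation {s} {d} s≤∣E∣ deg≤ds = balance s≤∣E∣ deg≤ds σ₀ V₀ (<-wellFounded (excess σ₀))
    where
    open Balancing d
    member : ∀ i → ∃ (_∈ E i)
    member i with nonempty? (E i)
    ... | yes nonempty = nonempty
    ... | no  empty    = contradiction (trans (cong ∣_∣ (Empty-unique empty)) (∣⊥∣≡0 n))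
                                       (≢-sym (<⇒≢ (<-≤-trans (>-nonZero⁻¹ s) (s≤∣E∣ i))))
    σ₀ : Assignment
    σ₀ = proj₁ ∘ member
    V₀ : Valid σ₀
    V₀ = proj₂ ∘ member

  -- Kernel method on the digraph with one arc per edge i, from σ i to a vertex of E i of the other 2-colour.
  balanced⇒choosable : ∀ {σ d} → Valid σ → (∀ v → load σ v ≤ d) →
                       ∀ c₂ → (∀ v → c₂ v ≤ 1) → (∀ i → Bichromatic c₂ (E i)) →
                       (L : Fin n → List ℕ) → (∀ v → length (L v) ≡ d + 1 × Unique (L v)) →
                       ∃ λ c → (∀ v → c v ∈ₗ L v) × ∀ i → Bichromatic c (E i)
  balanced⇒choosable {σ} {d} V load≤d c₂ c₂≤1 c₂-bichromatic L L-ok =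
    extract (bipartite⇒list-colourable bipartite L (proj₂ ∘ L-ok) ⊤ bounded)
    where
    head-choice : ∀ i → Σ (Fin n) λ h → h ∈ E i × c₂ (σ i) ≢ c₂ h
    head-choice i = differently-coloured c₂ (σ i) (c₂-bichromatic i)
    head : Fin m → Fin n
    head = proj₁ ∘ head-choice
    open Digraph σ head
    bounded : ∀ {v} → v ∈ ⊤ → outdegIn ⊤ v < length (L v)
    bounded {v} _ = begin-strict
      outdegIn ⊤ v     ≤⟨ outdegIn≤outdeg ⊤ v ⟩
      load σ v         ≤⟨ load≤d v ⟩
      d                <⟨ m<m+n d z<s ⟩
      d + 1            ≡⟨ proj₁ (L-ok v) ⟨
      length (L v)     ∎
      where open ≤-Reasoning
    bipartite : Bipartite (subsetOf (λ v → c₂ v ℕ.≟ 0))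
    bipartite = two-colouring⇒bipartite c₂ c₂≤1 (proj₂ ∘ proj₂ ∘ head-choice)
    extract : ∃ (ListColouring L ⊤) → ∃ λ c → (∀ v → c v ∈ₗ L v) × ∀ i → Bichromatic c (E i)
    extract (c , c∈L , c-proper) =
      c , (λ v → c∈L ∈⊤) , λ i → σ i , head i , V i , proj₁ (proj₂ (head-choice i)) , c-proper i ∈⊤ ∈⊤

length-filter≡∑ : ∀ {a p} {A : Set a} {P : Pred A p} (P? : Decidable P) (xs : List A) →
                  length (filter P? xs) ≡ ∑[ i < length xs ] 𝟙[ P? (lookup xs i) ]
length-filter≡∑ P? []       = refl
length-filter≡∑ P? (x ∷ xs) with P? x
... | yes _ = cong suc (length-filter≡∑ P? xs)
... | no  _ = length-filter≡∑ P? xs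

All-lookup⁺ : ∀ {a p} {A : Set a} {P : A → Set p} (xs : List A) → (∀ i → P (lookup xs i)) → All P xs
All-lookup⁺ {P = P} xs P[xs] = All.tabulate (λ x∈xs → subst P (sym (lookup-index x∈xs)) (P[xs] (index x∈xs)))

∈⇒≤foldr⊔ : ∀ {x} xs → x ∈ₗ xs → x ≤ foldr _⊔_ 0 xs
∈⇒≤foldr⊔ xs x∈xs =
  foldr-preservesᵒ (λ a b → [ m≤n⇒m≤n⊔o b , m≤n⇒m≤o⊔n a ]) 0 xs (inj₂ (Any.map ≤-reflexive x∈xs))

∈⇒minList≤ : ∀ {y} xs → y ∈ₗ xs → minList xs ≤ y
∈⇒minList≤ (x ∷ xs) y∈ = foldr-preservesᵒ (λ a b → [ m≤n⇒m⊓o≤n b , m≤n⇒o⊓m≤n a ]) x xs (first y∈)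
  where
  first : ∀ {y} → y ∈ₗ x ∷ xs → x ≤ y ⊎ Any (_≤ y) xs
  first (here refl)  = inj₁ ≤-refl
  first (there y∈xs) = inj₂ (Any.map (≤-reflexive ∘ sym) y∈xs)

nonempty⇒1≤∣p∣ : ∀ {n} {p : Subset n} → Nonempty p → 1 ≤ ∣ p ∣
nonempty⇒1≤∣p∣ {p = p} (u , u∈p) =
  subst (_≤ ∣ p ∣) (∣⁅x⁆∣≡1 u) (p⊆q⇒∣p∣≤∣q∣ (λ v∈⁅u⁆ → subst (_∈ p) (sym (x∈⁅y⁆⇒x≡y u v∈⁅u⁆)) u∈p))

1≤minList-sizes : ∀ {n} (es : List (Subset n)) → es ≢ [] → All Nonempty es → 1 ≤ minList (map ∣_∣ es)
1≤minList-sizes []       es≢[] _           = contradiction refl es≢[]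
1≤minList-sizes (e ∷ es) _     (ne ∷ nes)  =
  foldr-preservesᵇ {P = 1 ≤_} ⊓-glb (nonempty⇒1≤∣p∣ ne) (All-map⁺ (All.map nonempty⇒1≤∣p∣ nes))

m≤⌈m/n⌉*n : ∀ m n .{{_ : NonZero n}} → m ≤ ⌈ m / n ⌉ * n
m≤⌈m/n⌉*n m (suc b) = +-cancelʳ-≤ b m _ (begin
  m + b                                       ≡⟨ m≡m%n+[m/n]*n (m + b) (suc b) ⟩
  (m + b) % suc b + (m + b) / suc b * suc b   ≤⟨ +-monoˡ-≤ _ (s≤s⁻¹ (m%n<n (m + b) (suc b))) ⟩
  b + (m + b) / suc b * suc b                 ≡⟨ +-comm b _ ⟩
  (m + b) / suc b * suc b + b                 ∎)
  where open ≤-Reasoning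

corollary1 : (H : Hypergraph) → TwoColorable H → edges H ≢ [] →
    ChoiceNumber≤ H (⌈ maxDegree H / minEdgeSize H ⌉ + 1)
corollary1 H (c₂ , c₂≤1 , c₂-proper) edges≢[] = d + 1 , ≤-refl , choosable
  where
  es : List (Subset (n H))
  es = edges H
  s d : ℕ
  s = minEdgeSize H
  d = ⌈ maxDegree H / s ⌉
  instance
    s-nonZero : NonZero s
    s-nonZero = >-nonZero (1≤minList-sizes es edges≢[] (All.map (λ (u , _ , u∈e , _) → u , u∈e) c₂-proper))
  open Orientation (lookup es)
  deg≤ds : ∀ v → deg v ≤ d * s
  deg≤ds v = begin
    deg v            ≡⟨ length-filter≡∑ (v ∈?_) es ⟨
    degree H v       ≤⟨ ∈⇒≤foldr⊔ _ (∈-map⁺ (degree H) (∈-allFin v)) ⟩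
    maxDegree H      ≤⟨ m≤⌈m/n⌉*n (maxDegree H) s ⟩
    d * s            ∎
    where open ≤-Reasoning
  balanced : ∃ λ σ → Valid σ × ∀ v → load σ v ≤ d
  balanced = orientation (λ i → ∈⇒minList≤ (map ∣_∣ es) (∈-map⁺ ∣_∣ (∈-lookup i))) deg≤ds
  choosable : Choosable H (d + 1)
  choosable L L-ok = map₂ (map₂ (All-lookup⁺ es))
    (balanced⇒choosable (proj₁ (proj₂ balanced)) (proj₂ (proj₂ balanced))
                        c₂ c₂≤1 (All.lookup c₂-proper ∘ ∈-lookup) L L-ok)
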